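{- There exist a finite group $G$ and subgroups $H\leq A\leq G$ such that, for each $g\in G$, either $|A\{g,g^{ -1}\}A|/|A|$ is even or the left coset $gA$ contains an element $x$ with $x^2\in y^{ -1}Hy$ for some $y\in A$, and yet $A$ is not a perfect code of the pair $(G,H)$.
   Context: Graphs are finite, undirected and simple; a subset $C$ of the vertex set $V$ of a graph is a perfect code if every vertex in $V\setminus C$ is adjacent to exactly one vertex of $C$. For a group $G$, $H\leq G$ and an inverse-closed subset $U\subseteq G\setminus H$, the coset graph $\mathrm{Cos}(G,H,U)$ has vertices the left cosets of $H$ in $G$, with $xH$, $yH$ adjacent iff $x^{ -1}y\in HUH$. A subgroup $A$ with $H\leq A\leq G$ is a perfect code of the pair $(G,H)$ if for some such $U$ the set of left cosets of $H$ contained in $A$ is a perfect code in $\mathrm{Cos}(G,H,U)$. -}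

module Defs where

open import Data.Nat using (ℕ; _*_)
open import Data.Fin using (Fin; _≟_)
open import Data.Fin.Properties using (any?)
open import Data.Fin.Subset using (Subset; _∈_; _∉_; _⊆_; ∣_∣)
open import Data.Fin.Subset.Properties using (_∈?_)
open import Data.Vec using (tabulate)
open import Data.Product using (Σ; ∃; _×_; _,_)
open import Data.Sum using (_⊎_)
open import Relation.Nullary using (¬_; Dec; does)
open import Relation.Nullary.Decidable using (_×-dec_; _⊎-dec_)
open import Relation.Binary.PropositionalEquality using (_≡_)

-- A finite group, presented concretely on the carrier Fin order
-- (every finite group is isomorphic to one of this form).
record FinGroup : Set where
  field
    order : ℕ
    _·_   : Fin order → Fin order → Fin order
    e     : Fin order
    inv   : Fin order → Fin order
    assoc : ∀ x y z → (x · y) · z ≡ x · (y · z)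
    identityˡ : ∀ x → e · x ≡ x
    identityʳ : ∀ x → x · e ≡ x
    inverseˡ  : ∀ x → inv x · x ≡ e
    inverseʳ  : ∀ x → x · inv x ≡ e
  infixl 7 _·_

module _ (G : FinGroup) where
  open FinGroup G

  IsSubgroup : Subset order → Set
  IsSubgroup S = (e ∈ S)
               × (∀ {x y} → x ∈ S → y ∈ S → x · y ∈ S)
               × (∀ {x} → x ∈ S → inv x ∈ S)

  doubleCosetPair : Subset order → Fin order → Subset order
  doubleCosetPair A g = tabulate λ z → does
    (any? λ a → (a ∈? A) ×-dec any? λ b → (b ∈? A) ×-dec
       ((z ≟ a · g · b) ⊎-dec (z ≟ a · inv g · b)))

  RatioEven : Subset order → Fin order → Set
  RatioEven A g = ∃ λ k → ∣ doubleCosetPair A g ∣ ≡ (2 * k) * ∣ A ∣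

  SquareCondition : Subset order → Subset order → Fin order → Set
  SquareCondition H A g =
    ∃ λ x → (∃ λ a → a ∈ A × x ≡ g · a)
          × (∃ λ y → y ∈ A × (∃ λ h → h ∈ H × x · x ≡ inv y · h · y))

  InHUH : Subset order → Subset order → Fin order → Set
  InHUH H U z = ∃ λ h₁ → h₁ ∈ H × (∃ λ u → u ∈ U × (∃ λ h₂ → h₂ ∈ H × z ≡ h₁ · u · h₂))

  -- adjacency of the vertices xH and yH in Cos(G,H,U): x⁻¹y ∈ HUH
  CosAdj : Subset order → Subset order → Fin order → Fin order → Set
  CosAdj H U x y = InHUH H U (inv x · y)

  CosetIn : Subset order → Subset order → Fin order → Set
  CosetIn H A x = ∀ h → h ∈ H → x · h ∈ A

  SameCoset : Subset order → Fin order → Fin order → Set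
  SameCoset H x y = inv x · y ∈ H

  Admissible : Subset order → Subset order → Set
  Admissible H U = (∀ u → u ∈ U → inv u ∈ U) × (∀ u → u ∈ U → u ∉ H)

  -- the set of left cosets of H contained in A is a perfect code in Cos(G,H,U):
  -- every vertex xH outside this set is adjacent to exactly one vertex of it
  IsPerfectCodeCos : Subset order → Subset order → Subset order → Set
  IsPerfectCodeCos H U A = ∀ x → ¬ CosetIn H A x →
      (∃ λ y → CosetIn H A y × CosAdj H U x y)
    × (∀ y y′ → CosetIn H A y → CosetIn H A y′ →
         CosAdj H U x y → CosAdj H U x y′ → SameCoset H y y′)

  IsPerfectCodeOfPair : Subset order → Subset order → Set
  IsPerfectCodeOfPair H A = ∃ λ U → Admissible H U × IsPerfectCodeCos H U A

{-# OPTIONS --safe #-}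
-- Suppose H < A < G and G ∖ A is a single (H,H)-double coset. If xH is a vertex of
-- Cos(G,H,U) outside A, its neighbour yH ⊆ A gives some u ∈ U with x⁻¹y ∈ HuH; as
-- x⁻¹y ∉ A we get u ∉ A, hence HUH ⊇ HuH = G ∖ A ∋ x⁻¹a for every a ∈ A. So xH is
-- adjacent to every coset of H inside A, and there are at least two of them.
-- In D₄ = ⟨r, s⟩ with H = ⟨s⟩ and A = ⟨r², s⟩ we have G ∖ A = HrH, while every coset
-- gA contains an involution (e or the reflection rs), so the square condition holds.
module Submission where

open import Defs
open import Algebra.Bundles using (Group)
open import Level using (0ℓ)
open import Data.Fin using (Fin; #_; _≟_)
open import Data.Fin.Properties using (all?; any?)
open import Data.Fin.Subset using (Subset; _⊆_; _∈_; _∉_; inside; outside)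
open import Data.Fin.Subset.Properties using (_∈?_; _⊆?_)
open import Data.Product using (Σ; ∃; _×_; _,_)
open import Data.Sum using (_⊎_; inj₂)
open import Data.Vec using (Vec; lookup; _∷_; [])
open import Function using (_∘_)
open import Relation.Nullary using (¬_; Dec; ¬?)
open import Relation.Nullary.Decidable using (_×-dec_; _→-dec_; map′; from-yes; from-no)
open import Relation.Binary.PropositionalEquality
  using (_≡_; refl; trans; subst; cong; cong₂; isEquivalence)

toGroup : FinGroup → Group 0ℓ 0ℓ
toGroup G = record
  { Carrier = Fin order ; _≈_ = _≡_ ; _∙_ = _·_ ; ε = e ; _⁻¹ = inv
  ; isGroup = record
    { isMonoid = record
      { isSemigroup = record
        { isMagma = record { isEquivalence = isEquivalence ; ∙-cong = cong₂ _·_ }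
        ; assoc = assoc }
      ; identity = identityˡ , identityʳ }
    ; inverse = inverseˡ , inverseʳ
    ; ⁻¹-cong = cong inv }
  }
  where open FinGroup G

module _ (G : FinGroup) where
  open FinGroup G
  open import Algebra.Properties.Group (toGroup G) using (ε⁻¹≈ε; ⁻¹-involutive; //-rightDividesʳ)

  InDoubleCoset : Subset order → Fin order → Fin order → Set
  InDoubleCoset H u z = ∃ λ h₁ → h₁ ∈ H × ∃ λ h₂ → h₂ ∈ H × z ≡ h₁ · u · h₂

  ComplementIsDoubleCoset : Subset order → Subset order → Set
  ComplementIsDoubleCoset H A = ∀ u w → u ∉ A → w ∉ A → InDoubleCoset H u w

  module _ {H A : Subset order} where

    doubleCoset-⊆ : IsSubgroup G A → H ⊆ A → ∀ {u z} → u ∈ A → InDoubleCoset H u z → z ∈ A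
    doubleCoset-⊆ (_ , ·-closed , _) H⊆A u∈A (h₁ , h₁∈H , h₂ , h₂∈H , refl) =
      ·-closed (·-closed (H⊆A h₁∈H) u∈A) (H⊆A h₂∈H)

    inv·-∉ : IsSubgroup G A → ∀ {x y} → x ∉ A → y ∈ A → inv x · y ∉ A
    inv·-∉ (_ , ·-closed , inv-closed) {x} {y} x∉A y∈A x⁻¹y∈A = x∉A
      (subst (_∈ A) (⁻¹-involutive x) (inv-closed
        (subst (_∈ A) (//-rightDividesʳ y (inv x)) (·-closed x⁻¹y∈A (inv-closed y∈A)))))

    cosetIn⇒∈ : e ∈ H → ∀ {y} → CosetIn G H A y → y ∈ A
    cosetIn⇒∈ e∈H {y} yH⊆A = subst (_∈ A) (identityʳ y) (yH⊆A e e∈H)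

    ∈⇒cosetIn : IsSubgroup G A → H ⊆ A → ∀ {y} → y ∈ A → CosetIn G H A y
    ∈⇒cosetIn (_ , ·-closed , _) H⊆A y∈A h h∈H = ·-closed y∈A (H⊆A h∈H)

    sameCoset-e⇒∈ : ∀ {a} → SameCoset G H e a → a ∈ H
    sameCoset-e⇒∈ {a} = subst (_∈ H) (trans (cong (_· a) ε⁻¹≈ε) (identityˡ a))

    complementIsDoubleCoset⇒¬perfectCode :
      IsSubgroup G H → IsSubgroup G A → H ⊆ A →
      (∃ λ a → a ∈ A × a ∉ H) → (∃ λ x → x ∉ A) →
      ComplementIsDoubleCoset H A → ¬ IsPerfectCodeOfPair G H A
    complementIsDoubleCoset⇒¬perfectCode (e∈H , _) A≤G@(e∈A , _) H⊆A (a , a∈A , a∉H) (x , x∉A)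
      complement (U , _ , perfect) with perfect x (x∉A ∘ cosetIn⇒∈ e∈H)
    ... | (y , yH⊆A , h₁ , h₁∈H , u , u∈U , h₂ , h₂∈H , x⁻¹y≡h₁uh₂) , unique =
      a∉H (sameCoset-e⇒∈ (unique e a (∈⇒cosetIn A≤G H⊆A e∈A) (∈⇒cosetIn A≤G H⊆A a∈A)
                                     (adjacent e∈A) (adjacent a∈A)))
      where
      u∉A : u ∉ A
      u∉A u∈A = inv·-∉ A≤G x∉A (cosetIn⇒∈ e∈H yH⊆A)
        (doubleCoset-⊆ A≤G H⊆A u∈A (h₁ , h₁∈H , h₂ , h₂∈H , x⁻¹y≡h₁uh₂))

      adjacent : ∀ {b} → b ∈ A → CosAdj G H U x b
      adjacent {b} b∈A with complement u (inv x · b) u∉A (inv·-∉ A≤G x∉A b∈A)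
      ... | k₁ , k₁∈H , k₂ , k₂∈H , x⁻¹b≡k₁uk₂ = k₁ , k₁∈H , u , u∈U , k₂ , k₂∈H , x⁻¹b≡k₁uk₂

  isSubgroup? : ∀ S → Dec (IsSubgroup G S)
  isSubgroup? S = (e ∈? S)
    ×-dec map′ (λ closed {x} {y} → closed x y) (λ closed x y → closed)
                (all? λ x → all? λ y → (x ∈? S) →-dec (y ∈? S) →-dec (x · y ∈? S))
    ×-dec map′ (λ closed {x} → closed x) (λ closed x → closed)
                (all? λ x → (x ∈? S) →-dec (inv x ∈? S))

  inDoubleCoset? : ∀ H u z → Dec (InDoubleCoset H u z)
  inDoubleCoset? H u z =
    any? λ h₁ → (h₁ ∈? H) ×-dec any? λ h₂ → (h₂ ∈? H) ×-dec (z ≟ h₁ · u · h₂)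

  complementIsDoubleCoset? : ∀ H A → Dec (ComplementIsDoubleCoset H A)
  complementIsDoubleCoset? H A = all? λ u → all? λ w →
    ¬? (u ∈? A) →-dec ¬? (w ∈? A) →-dec inDoubleCoset? H u w

  squareCondition? : ∀ H A g → Dec (SquareCondition G H A g)
  squareCondition? H A g = any? λ x →
        (any? λ a → (a ∈? A) ×-dec (x ≟ g · a))
    ×-dec (any? λ y → (y ∈? A) ×-dec any? λ h → (h ∈? H) ×-dec (x · x ≟ inv y · h · y))

-- Index i + 4j encodes rⁱsʲ, where r⁴ = s² = e and s r = r⁻¹ s.
D₄-table : Vec (Vec (Fin 8) 8) 8
D₄-table =
  (# 0 ∷ # 1 ∷ # 2 ∷ # 3 ∷ # 4 ∷ # 5 ∷ # 6 ∷ # 7 ∷ []) ∷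
  (# 1 ∷ # 2 ∷ # 3 ∷ # 0 ∷ # 5 ∷ # 6 ∷ # 7 ∷ # 4 ∷ []) ∷
  (# 2 ∷ # 3 ∷ # 0 ∷ # 1 ∷ # 6 ∷ # 7 ∷ # 4 ∷ # 5 ∷ []) ∷
  (# 3 ∷ # 0 ∷ # 1 ∷ # 2 ∷ # 7 ∷ # 4 ∷ # 5 ∷ # 6 ∷ []) ∷
  (# 4 ∷ # 7 ∷ # 6 ∷ # 5 ∷ # 0 ∷ # 3 ∷ # 2 ∷ # 1 ∷ []) ∷
  (# 5 ∷ # 4 ∷ # 7 ∷ # 6 ∷ # 1 ∷ # 0 ∷ # 3 ∷ # 2 ∷ []) ∷
  (# 6 ∷ # 5 ∷ # 4 ∷ # 7 ∷ # 2 ∷ # 1 ∷ # 0 ∷ # 3 ∷ []) ∷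
  (# 7 ∷ # 6 ∷ # 5 ∷ # 4 ∷ # 3 ∷ # 2 ∷ # 1 ∷ # 0 ∷ []) ∷ []

D₄-inverses : Vec (Fin 8) 8
D₄-inverses = # 0 ∷ # 3 ∷ # 2 ∷ # 1 ∷ # 4 ∷ # 5 ∷ # 6 ∷ # 7 ∷ []

D₄ : FinGroup
D₄ = record
  { order = 8 ; _·_ = _·_ ; e = # 0 ; inv = inv
  ; assoc     = from-yes (all? λ x → all? λ y → all? λ z → (x · y) · z ≟ x · (y · z))
  ; identityˡ = from-yes (all? λ x → # 0 · x ≟ x)
  ; identityʳ = from-yes (all? λ x → x · # 0 ≟ x)
  ; inverseˡ  = from-yes (all? λ x → inv x · x ≟ # 0)
  ; inverseʳ  = from-yes (all? λ x → x · inv x ≟ # 0)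
  }
  where
  infixl 7 _·_
  _·_ : Fin 8 → Fin 8 → Fin 8
  x · y = lookup (lookup D₄-table x) y
  inv : Fin 8 → Fin 8
  inv = lookup D₄-inverses

H A : Subset 8
H = inside ∷ outside ∷ outside ∷ outside ∷ inside ∷ outside ∷ outside ∷ outside ∷ []
A = inside ∷ outside ∷ inside ∷ outside ∷ inside ∷ outside ∷ inside ∷ outside ∷ []

corollary3p8 : Σ FinGroup λ G → ∃ λ (H : Subset (FinGroup.order G)) → ∃ λ (A : Subset (FinGroup.order G)) →
    IsSubgroup G H × IsSubgroup G A × H ⊆ A
    × (∀ g → RatioEven G A g ⊎ SquareCondition G H A g)
    × ¬ IsPerfectCodeOfPair G H A
corollary3p8 = D₄ , H , A , H≤D₄ , A≤D₄ , H⊆A , (λ g → inj₂ (squareCondition g)) ,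
  complementIsDoubleCoset⇒¬perfectCode D₄ H≤D₄ A≤D₄ H⊆A
    (# 2 , from-yes (# 2 ∈? A) , from-no (# 2 ∈? H))
    (# 1 , from-no (# 1 ∈? A))
    (from-yes (complementIsDoubleCoset? D₄ H A))
  where
  H≤D₄ : IsSubgroup D₄ H
  H≤D₄ = from-yes (isSubgroup? D₄ H)
  A≤D₄ : IsSubgroup D₄ A
  A≤D₄ = from-yes (isSubgroup? D₄ A)
  H⊆A : H ⊆ A
  H⊆A = from-yes (H ⊆? A)
  squareCondition : ∀ g → SquareCondition D₄ H A g
  squareCondition = from-yes (all? (squareCondition? D₄ H A))
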